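{- Let $P=P_\bullet\sqcup P_\star$ be a starred poset and $Q=Q_{(P_\bullet,P_\star)}$ its associated starred quiver. Suppose $P$ is ranked with rank function $R$. Then the translated marked order polytope $\overline{\mathcal O}_R(P)=\mathcal O_R(P)-\mathbf u$, where $\mathbf u=(R(v))_{v\in P_\bullet}$, is the polar dual of the root polytope $\mathrm{Root}(Q)$.
   Context: A starred poset is a finite poset $P$ whose Hasse diagram is connected, with a decomposition $P=P_\bullet\sqcup P_\star$, $P_\bullet=\{v_1,\dots,v_n\}$ nonempty, such that $P_\star$ contains all minimal and maximal elements of $P$ and no two elements of $P_\star$ are related by a covering relation. Its starred quiver $Q$ is the Hasse diagram of $P$ with every edge directed from the smaller to the larger element, with normal vertices $P_\bullet$ and starred vertices $P_\star$. For each arrow $a$ define $u_a\in\mathbb R^n$: $u_a=e_j-e_i$ if $a:v_i\to v_j$; $u_a=e_j$ if $a$ goes from a starred vertex to $v_j$; $u_a=-e_i$ if $a$ goes from $v_i$ to a starred vertex; $\mathrm{Root}(Q)=\mathrm{Conv}\{u_a\}\subset\mathbb R^n$. $P$ is ranked if, after adjoining a new minimum $\hat 0$, for each $v\in P$ all maximal chains from $\hat 0$ to $v$ in $P\cup\{\hat0\}$ have the same length; this length is $R(v)$. The marked order polytope $\mathcal O_R(P)\subset\mathbb R^{P_\bullet}=\mathbb R^n$ is the set of $f:P_\bullet\to\mathbb R$ with $R(\star)\le f(v)$ whenever $\star\le v$ ($\star\in P_\star$, $v\in P_\bullet$), $f(v)\le R(\star)$ whenever $v\le\star$, and $f(v)\le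 f(w)$ whenever $v\le w$ in $P_\bullet$. The polar dual of $\mathbf P\subset\mathbb R^n$ is $\{y\in\mathbb R^n: x\cdot y\ge -1\ \forall x\in\mathbf P\}$.
   Formalization: The root polytope, its polar dual and the translated marked order polytope are taken over ℚ^n rather than ℝ^n, with rational weights in the convex hull. -}

module Defs where

open import Level using (0ℓ)
open import Data.Nat using (ℕ; zero; suc)
open import Data.Fin using (Fin; zero; suc; _≟_)
open import Data.Sum using (_⊎_; inj₁; inj₂)
open import Data.Product using (Σ; ∃; _×_; _,_)
open import Data.List using (List; []; _∷_)
open import Data.Integer using (+_)
open import Data.Rational using (ℚ; 0ℚ; 1ℚ; _+_; _*_; -_; _-_; _≤_; _/_)
open import Relation.Nullary using (¬_; yes; no)
open import Relation.Binary.PropositionalEquality using (_≡_)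
open import Relation.Binary.Structures using (IsPartialOrder)
open import Relation.Binary.Construct.Closure.ReflexiveTransitive using (Star)

-- Finite posets with a distinguished decomposition P = P• ⊔ P⋆.
-- The carrier is Fin n ⊎ Fin k : inj₁ i is the normal element v_i,
-- inj₂ j is the j-th starred element.

Elt : ℕ → ℕ → Set
Elt n k = Fin n ⊎ Fin k

record FinPoset (n k : ℕ) : Set₁ where
  field
    _≼_       : Elt n k → Elt n k → Set
    isPartialOrder : IsPartialOrder _≡_ _≼_

module _ {n k : ℕ} (P : FinPoset n k) where
  open FinPoset P

  _≺_ : Elt n k → Elt n k → Set
  x ≺ y = x ≼ y × ¬ (x ≡ y)

  Covers : Elt n k → Elt n k → Set
  Covers x y = x ≺ y × (∀ z → x ≺ z → z ≺ y → Data.Empty.⊥)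
    where import Data.Empty

  HasseEdge : Elt n k → Elt n k → Set
  HasseEdge x y = Covers x y ⊎ Covers y x

  HasseConnected : Set
  HasseConnected = ∀ x y → Star HasseEdge x y

  Minimal : Elt n k → Set
  Minimal x = ∀ y → y ≼ x → y ≡ x

  Maximal : Elt n k → Set
  Maximal x = ∀ y → x ≼ y → y ≡ x

  IsStarred : Elt n k → Set
  IsStarred x = Σ (Fin k) (λ j → x ≡ inj₂ j)

  -- P is a starred poset (P• = inj₁-part is nonempty, i.e. n = suc _,
  -- is imposed separately).
  record IsStarredPoset : Set where
    field
      connected    : HasseConnected
      minStarred   : ∀ x → Minimal x → IsStarred x
      maxStarred   : ∀ x → Maximal x → IsStarred x
      noStarCover  : ∀ i j → ¬ Covers (inj₂ i) (inj₂ j)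

  -- Maximal chains 0̂ ⋖ x₁ ⋖ ... ⋖ v in P ∪ {0̂} of length ℓ
  -- (ℓ = number of covering steps, the first being 0̂ ⋖ x₁ with x₁ minimal in P).
  data ChainFrom0 : Elt n k → ℕ → Set where
    base : ∀ {x} → Minimal x → ChainFrom0 x 1
    step : ∀ {x y ℓ} → ChainFrom0 x ℓ → Covers x y → ChainFrom0 y (suc ℓ)

  IsRankFunction : (Elt n k → ℕ) → Set
  IsRankFunction R = ∀ v ℓ → ChainFrom0 v ℓ → R v ≡ ℓ

Vecℚ : ℕ → Set
Vecℚ n = Fin n → ℚ

sumℚ : ∀ {n} → Vecℚ n → ℚ
sumℚ {zero}  f = 0ℚ
sumℚ {suc n} f = f zero + sumℚ (λ i → f (suc i))

_·_ : ∀ {n} → Vecℚ n → Vecℚ n → ℚ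
x · y = sumℚ (λ i → x i * y i)

_≗ℚ_ : ∀ {n} → Vecℚ n → Vecℚ n → Set
x ≗ℚ y = ∀ i → x i ≡ y i

ℕtoℚ : ℕ → ℚ
ℕtoℚ m = (+ m) / 1

e : ∀ {n} → Fin n → Vecℚ n
e i j with i ≟ j
... | yes _ = 1ℚ
... | no _  = 0ℚ

weightedSum : ∀ {n} → List (ℚ × Vecℚ n) → Vecℚ n
weightedSum []              i = 0ℚ
weightedSum ((λ₀ , x) ∷ ws) i = λ₀ * x i + weightedSum ws i

weightTotal : ∀ {n} → List (ℚ × Vecℚ n) → ℚ
weightTotal []              = 0ℚ
weightTotal ((λ₀ , _) ∷ ws) = λ₀ + weightTotal ws

data AllConvexData {n} (S : Vecℚ n → Set) : List (ℚ × Vecℚ n) → Set where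
  []  : AllConvexData S []
  _∷_ : ∀ {λ₀ x ws} → (0ℚ ≤ λ₀) × S x → AllConvexData S ws → AllConvexData S ((λ₀ , x) ∷ ws)

Conv : ∀ {n} → (Vecℚ n → Set) → Vecℚ n → Set
Conv S y = Σ (List (ℚ × Vecℚ _)) λ ws →
  AllConvexData S ws × weightTotal ws ≡ 1ℚ × weightedSum ws ≗ℚ y

PolarDual : ∀ {n} → (Vecℚ n → Set) → Vecℚ n → Set
PolarDual S y = ∀ x → S x → - 1ℚ ≤ x · y

module _ {n k : ℕ} (P : FinPoset n k) where
  open FinPoset P

  -- u_a for an arrow a : x → y (arrows = covering relations x ⋖ y)
  arrowVec : Elt n k → Elt n k → Vecℚ n
  arrowVec (inj₁ i) (inj₁ j) t = e j t - e i t
  arrowVec (inj₂ _) (inj₁ j) t = e j t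
  arrowVec (inj₁ i) (inj₂ _) t = - e i t
  arrowVec (inj₂ _) (inj₂ _) t = 0ℚ   -- no such arrows in a starred quiver

  RootVectors : Vecℚ n → Set
  RootVectors u = Σ (Elt n k) λ x → Σ (Elt n k) λ y →
    Covers P x y × u ≗ℚ arrowVec x y

  Root : Vecℚ n → Set
  Root = Conv RootVectors

  MarkedOrderPolytope : (Elt n k → ℕ) → Vecℚ n → Set
  MarkedOrderPolytope R f =
    (∀ j i → inj₂ j ≼ inj₁ i → ℕtoℚ (R (inj₂ j)) ≤ f i) ×
    (∀ i j → inj₁ i ≼ inj₂ j → f i ≤ ℕtoℚ (R (inj₂ j))) ×
    (∀ i i' → inj₁ i ≼ inj₁ i' → f i ≤ f i')

  TranslatedMOP : (Elt n k → ℕ) → Vecℚ n → Set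
  TranslatedMOP R y = Σ (Vecℚ n) λ f →
    MarkedOrderPolytope R f × y ≗ℚ (λ i → f i - ℕtoℚ (R (inj₁ i)))

-- Write y = f − R on P• and extend f to all of P by the marking R on P⋆.
-- For an arrow x → z of the quiver, x ⋖ z and P is ranked, so R z = R x + 1
-- and u · y = (f z − R z) − (f x − R x) = f z − f x − 1: the facet inequality
-- u · y ≥ −1 says exactly f x ≤ f z.  Hence y is in the polar dual of the arrow
-- vectors (equivalently of their convex hull Root Q) iff f is monotone along
-- covers, iff f is order preserving, since in a finite poset every relation is
-- a chain of covers; and that is membership of f in O_R(P).  Constructively the
-- order of the finite carrier is only decidable up to double negation, which
-- suffices because every goal is a decidable inequality of rationals.

module Submission where

open import Defs
open import Data.Nat using (ℕ; suc)
open import Data.Sum using (_⊎_; inj₁; inj₂)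
open import Data.Product using (_×_)

open import Algebra.Bundles using (CommutativeRing)
open import Data.Empty using (⊥-elim)
open import Data.Fin using (Fin; zero; suc; punchIn; _≟_)
open import Data.Fin.Induction using (spo-wellFounded)
open import Data.Fin.Properties using (any?; sequence; +↔⊎; punchInᵢ≢i)
import Data.Integer as ℤ
import Data.Integer.Properties as ℤ
open import Data.List using ([]; _∷_)
import Data.Nat as ℕ
open import Data.Nat.Coprimality using (1-coprimeTo) renaming (sym to coprime-sym)
import Data.Nat.Properties as ℕ
open import Data.Product using (∃; _,_; proj₁)
open import Data.Rational
  using (ℚ; mkℚ; 0ℚ; 1ℚ; _+_; _*_; -_; _-_; _≤_; _/_; _≤?_; nonNegative)
open import Data.Rational.Properties
  using ( normalize-coprime; +-*-commutativeRing; +-monoˡ-≤; +-mono-≤; *-monoˡ-≤-nonNeg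
        ; ≤-refl; ≤-trans; ≤-reflexive; nonNegative⁻¹
        ; +-assoc; +-identityʳ; +-inverseʳ; *-assoc; *-identityˡ; *-zeroˡ; *-distribʳ-+)
open import Data.Rational.Solver using (module +-*-Solver)
open import Data.Sum using ([_,_]′)
open import Data.Sum.Properties using (≡-dec)
open import Data.Vec.Functional using (replicate)
open import Effect.Monad using (RawMonad)
open import Function using (_∘_; flip; _⇔_; mk⇔; Equivalence; _↔_; Inverse)
open import Induction.WellFounded using (WellFounded; Acc; acc; module Subrelation)
open import Relation.Binary.Core using (Rel)
open import Relation.Binary.Definitions using (Decidable)
open import Relation.Binary.Structures using (IsPartialOrder; IsStrictPartialOrder)
open import Relation.Binary.PropositionalEquality
  using (_≡_; _≗_; refl; sym; trans; cong; cong₂; subst; subst₂; module ≡-Reasoning)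
open import Relation.Binary.Construct.Closure.ReflexiveTransitive using (Star; ε; _◅_; _◅◅_; fold)
import Relation.Binary.Construct.Flip.EqAndOrd as Flip
import Relation.Binary.Construct.NonStrictToStrict as ToStrict
import Relation.Binary.Construct.On as On
open import Relation.Nullary using (Dec; yes; no; ¬_)
open import Relation.Nullary.Decidable using (map′; _×-dec_; ¬?; decidable-stable; ¬¬-excluded-middle)
open import Relation.Nullary.Negation using (¬¬-Monad; ¬¬-map)
open import Relation.Unary using (Pred)

open import Algebra.Properties.Semiring.Sum (CommutativeRing.semiring +-*-commutativeRing)
  using (sum; sum-cong-≗; ∑-distrib-+; *-distribˡ-sum; sum-remove; sum-replicate-zero)

open +-*-Solver using (solve; _:+_; _:*_; :-_; _:-_; con; _:=_)
open ≡-Reasoning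

ℕtoℚ-suc : ∀ m → ℕtoℚ (suc m) ≡ ℕtoℚ m + 1ℚ
ℕtoℚ-suc m = begin
  ℤ.+ suc m / 1                                    ≡⟨ cong (λ l → ℤ.+ l / 1) (ℕ.+-comm 1 m) ⟩
  (ℤ.+ m ℤ.+ ℤ.+ 1) / 1                            ≡⟨ cong (λ z → (z ℤ.+ ℤ.+ 1) / 1) (ℤ.*-identityʳ (ℤ.+ m)) ⟨
  (ℤ.+ m ℤ.* ℤ.+ 1 ℤ.+ ℤ.+ 1 ℤ.* ℤ.+ 1) / (1 ℕ.* 1) ≡⟨⟩  -- _+_ computes once both summands are normal forms
  mkℚ (ℤ.+ m) 0 (coprime-sym (1-coprimeTo m)) + mkℚ (ℤ.+ 1) 0 (1-coprimeTo 1)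
    ≡⟨ cong₂ _+_ (normalize-coprime (coprime-sym (1-coprimeTo m))) (normalize-coprime (1-coprimeTo 1)) ⟨
  ℕtoℚ m + 1ℚ                                      ∎

p+q-q≡p : ∀ p q → p + q - q ≡ p
p+q-q≡p p q = trans (+-assoc p q (- q)) (trans (cong (p +_) (+-inverseʳ q)) (+-identityʳ p))

+-cancelʳ-≤⇔ : ∀ r {p q} → (p ≤ q) ⇔ (p + r ≤ q + r)
+-cancelʳ-≤⇔ r {p} {q} = mk⇔ (+-monoˡ-≤ r) (λ p+r≤q+r →
  subst₂ _≤_ (p+q-q≡p p r) (p+q-q≡p q r) (+-monoˡ-≤ (- r) p+r≤q+r))

-1≤[b-[s+1]]-[a-s]⇔a≤b : ∀ a b s → (- 1ℚ ≤ (b - (s + 1ℚ)) - (a - s)) ⇔ (a ≤ b)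
-1≤[b-[s+1]]-[a-s]⇔a≤b a b s =
  subst₂ (λ p q → (- 1ℚ ≤ (b - (s + 1ℚ)) - (a - s)) ⇔ (p ≤ q))
    (solve 1 (λ a → :- con 1ℚ :+ (a :+ con 1ℚ) := a) refl a)
    (solve 3 (λ a b s → (b :- (s :+ con 1ℚ)) :- (a :- s) :+ (a :+ con 1ℚ) := b) refl a b s)
    (+-cancelʳ-≤⇔ (a + 1ℚ))

sumℚ≡sum : ∀ {n} (f : Vecℚ n) → sumℚ f ≡ sum f
sumℚ≡sum {ℕ.zero} f = refl
sumℚ≡sum {suc n}  f = cong (f zero +_) (sumℚ≡sum (f ∘ suc))

·-linearˡ : ∀ {n} (c : ℚ) (u w v : Vecℚ n) →
            (λ t → c * u t + w t) · v ≡ c * (u · v) + w · v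
·-linearˡ c u w v = begin
  (λ t → c * u t + w t) · v                     ≡⟨ sumℚ≡sum (λ t → (c * u t + w t) * v t) ⟩
  sum (λ t → (c * u t + w t) * v t)             ≡⟨ sum-cong-≗ distrib ⟩
  sum (λ t → c * (u t * v t) + w t * v t)       ≡⟨ ∑-distrib-+ (λ t → c * (u t * v t)) (λ t → w t * v t) ⟩
  sum (λ t → c * (u t * v t)) + sum (λ t → w t * v t)
    ≡⟨ cong₂ _+_ (*-distribˡ-sum c (λ t → u t * v t)) (sumℚ≡sum (λ t → w t * v t)) ⟨
  c * sum (λ t → u t * v t) + w · v             ≡⟨ cong (λ x → c * x + w · v) (sumℚ≡sum (λ t → u t * v t)) ⟨
  c * (u · v) + w · v                           ∎
  where
  distrib : ∀ t → (c * u t + w t) * v t ≡ c * (u t * v t) + w t * v t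
  distrib t = trans (*-distribʳ-+ (v t) (c * u t) (w t)) (cong (_+ w t * v t) (*-assoc c (u t) (v t)))

·-zeroˡ : ∀ {n} (v : Vecℚ n) → (λ _ → 0ℚ) · v ≡ 0ℚ
·-zeroˡ {n} v = begin
  (λ _ → 0ℚ) · v          ≡⟨ sumℚ≡sum (λ t → 0ℚ * v t) ⟩
  sum (λ t → 0ℚ * v t)    ≡⟨ sum-cong-≗ (λ t → *-zeroˡ (v t)) ⟩
  sum (replicate n 0ℚ)    ≡⟨ sum-replicate-zero n ⟩
  0ℚ                      ∎

e-diagonal : ∀ {n} (i : Fin n) → e i i ≡ 1ℚ
e-diagonal i with i ≟ i
... | yes _  = refl
... | no i≢i = ⊥-elim (i≢i refl)

e-offDiagonal : ∀ {n} {i j : Fin n} → ¬ i ≡ j → e i j ≡ 0ℚ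
e-offDiagonal {i = i} {j} i≢j with i ≟ j
... | yes i≡j = ⊥-elim (i≢j i≡j)
... | no _    = refl

e-· : ∀ {n} (i : Fin n) (v : Vecℚ n) → e i · v ≡ v i
e-· {suc n} i v = begin
  e i · v                                                  ≡⟨ sumℚ≡sum eᵢv ⟩
  sum eᵢv                                                  ≡⟨ sum-remove eᵢv ⟩
  e i i * v i + sum (eᵢv ∘ punchIn i)                      ≡⟨ cong₂ _+_ (cong (_* v i) (e-diagonal i)) (sum-cong-≗ off) ⟩
  1ℚ * v i + sum (replicate n 0ℚ)                          ≡⟨ cong₂ _+_ (*-identityˡ (v i)) (sum-replicate-zero n) ⟩
  v i + 0ℚ                                                 ≡⟨ +-identityʳ (v i) ⟩
  v i                                                      ∎
  where
  eᵢv : Vecℚ (suc n)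
  eᵢv t = e i t * v t
  off : ∀ j → eᵢv (punchIn i j) ≡ 0ℚ
  off j = trans (cong (_* v (punchIn i j)) (e-offDiagonal (punchInᵢ≢i i j ∘ sym))) (*-zeroˡ (v (punchIn i j)))

·-congˡ : ∀ {n} {u w : Vecℚ n} (v : Vecℚ n) → u ≗ w → u · v ≡ w · v
·-congˡ {u = u} {w} v u≗w = begin
  u · v                  ≡⟨ sumℚ≡sum (λ t → u t * v t) ⟩
  sum (λ t → u t * v t)  ≡⟨ sum-cong-≗ (λ t → cong (_* v t) (u≗w t)) ⟩
  sum (λ t → w t * v t)  ≡⟨ sumℚ≡sum (λ t → w t * v t) ⟨
  w · v                  ∎

∈⇒∈Conv : ∀ {n} {S : Vecℚ n → Set} {x : Vecℚ n} → S x → Conv S x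
∈⇒∈Conv {x = x} x∈S =
  ((1ℚ , x) ∷ []) , (nonNegative⁻¹ 1ℚ , x∈S) ∷ [] , +-identityʳ 1ℚ ,
  λ t → trans (+-identityʳ (1ℚ * x t)) (*-identityˡ (x t))

weightedSum-·-lowerBound : ∀ {n} {S : Vecℚ n → Set} {v : Vecℚ n} → PolarDual S v →
  ∀ {ws} → AllConvexData S ws → - weightTotal ws ≤ weightedSum ws · v
weightedSum-·-lowerBound {v = v} S° [] = ≤-reflexive (sym (·-zeroˡ v))
weightedSum-·-lowerBound {v = v} S° {(c , x) ∷ ws} ((0≤c , x∈S) ∷ ws∈S) =
  subst₂ _≤_
    (solve 2 (λ c w → c :* (:- con 1ℚ) :+ (:- w) := :- (c :+ w)) refl c (weightTotal ws))
    (sym (·-linearˡ c x (weightedSum ws) v))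
    (+-mono-≤ (*-monoˡ-≤-nonNeg c {{nonNegative 0≤c}} (S° x x∈S)) (weightedSum-·-lowerBound S° ws∈S))

PolarDual-Conv : ∀ {n} {S : Vecℚ n → Set} {v : Vecℚ n} → PolarDual S v → PolarDual (Conv S) v
PolarDual-Conv {v = v} S° x (ws , ws∈S , total≡1 , ws≗x) =
  subst₂ _≤_ (cong -_ total≡1) (·-congˡ v ws≗x) (weightedSum-·-lowerBound S° ws∈S)

basisVec : ∀ {n k} → Elt n k → Vecℚ n
basisVec (inj₁ i) = e i
basisVec (inj₂ _) = λ _ → 0ℚ

extendByZero : ∀ {n k} → Vecℚ n → Elt n k → ℚ
extendByZero v = [ v , (λ _ → 0ℚ) ]′

basisVec-· : ∀ {n k} (x : Elt n k) (v : Vecℚ n) → basisVec x · v ≡ extendByZero v x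
basisVec-· (inj₁ i) v = e-· i v
basisVec-· (inj₂ _) v = ·-zeroˡ v

arrowVec≗ : ∀ {n k} (P : FinPoset n k) x y → arrowVec P x y ≗ (λ t → - 1ℚ * basisVec x t + basisVec y t)
arrowVec≗ P (inj₁ i) (inj₁ j) t = solve 2 (λ p q → q :- p := :- con 1ℚ :* p :+ q) refl (e i t) (e j t)
arrowVec≗ P (inj₂ _) (inj₁ j) t = solve 1 (λ q → q := :- con 1ℚ :* con 0ℚ :+ q) refl (e j t)
arrowVec≗ P (inj₁ i) (inj₂ _) t = solve 1 (λ p → :- p := :- con 1ℚ :* p :+ con 0ℚ) refl (e i t)
arrowVec≗ P (inj₂ _) (inj₂ _) t = solve 0 (con 0ℚ := :- con 1ℚ :* con 0ℚ :+ con 0ℚ) refl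

arrowVec-· : ∀ {n k} (P : FinPoset n k) x y (v : Vecℚ n) →
             arrowVec P x y · v ≡ extendByZero v y - extendByZero v x
arrowVec-· P x y v = begin
  arrowVec P x y · v                              ≡⟨ ·-congˡ v (arrowVec≗ P x y) ⟩
  (λ t → - 1ℚ * basisVec x t + basisVec y t) · v  ≡⟨ ·-linearˡ (- 1ℚ) (basisVec x) (basisVec y) v ⟩
  - 1ℚ * (basisVec x · v) + basisVec y · v        ≡⟨ cong₂ (λ p q → - 1ℚ * p + q) (basisVec-· x v) (basisVec-· y v) ⟩
  - 1ℚ * extendByZero v x + extendByZero v y      ≡⟨ solve 2 (λ p q → :- con 1ℚ :* p :+ q := q :- p) refl (extendByZero v x) (extendByZero v y) ⟩
  extendByZero v y - extendByZero v x             ∎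

rank : ∀ {n k} → (Elt n k → ℕ) → Elt n k → ℚ
rank R = ℕtoℚ ∘ R

extendByMarking : ∀ {n k} → (Elt n k → ℕ) → Vecℚ n → Elt n k → ℚ
extendByMarking R f = [ f , rank R ∘ inj₂ ]′

extendByZero-translate : ∀ {n k} (R : Elt n k → ℕ) {f y : Vecℚ n} →
  y ≗ (λ i → f i - rank R (inj₁ i)) → ∀ x → extendByZero y x ≡ extendByMarking R f x - rank R x
extendByZero-translate R y≗f-R (inj₁ i) = y≗f-R i
extendByZero-translate R y≗f-R (inj₂ j) = sym (+-inverseʳ (rank R (inj₂ j)))

module _ {n k} (P : FinPoset n k) (R : Elt n k → ℕ) {f : Vecℚ n} where
  open FinPoset P

  monotone⇒MarkedOrderPolytope :
    (∀ {x y} → x ≼ y → extendByMarking R f x ≤ extendByMarking R f y) → MarkedOrderPolytope P R f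
  monotone⇒MarkedOrderPolytope mono = (λ _ _ → mono) , (λ _ _ → mono) , (λ _ _ → mono)

  MarkedOrderPolytope⇒⋖-monotone : IsStarredPoset P → MarkedOrderPolytope P R f →
    ∀ {x y} → Covers P x y → extendByMarking R f x ≤ extendByMarking R f y
  MarkedOrderPolytope⇒⋖-monotone _ (_ , _ , f-mono) {inj₁ i} {inj₁ j} x⋖y = f-mono i j (proj₁ (proj₁ x⋖y))
  MarkedOrderPolytope⇒⋖-monotone _ (f-lower , _ , _) {inj₂ i} {inj₁ j} x⋖y = f-lower i j (proj₁ (proj₁ x⋖y))
  MarkedOrderPolytope⇒⋖-monotone _ (_ , f-upper , _) {inj₁ i} {inj₂ j} x⋖y = f-upper i j (proj₁ (proj₁ x⋖y))
  MarkedOrderPolytope⇒⋖-monotone P-starred _ {inj₂ i} {inj₂ j} x⋖y =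
    ⊥-elim (IsStarredPoset.noStarCover P-starred i j x⋖y)

module FiniteType {a} {A : Set a} {N : ℕ} (A↔Fin : Fin N ↔ A) where
  open Inverse A↔Fin using (to; from; strictlyInverseˡ)

  ∃? : ∀ {p} {P : Pred A p} → (∀ x → Dec (P x)) → Dec (∃ P)
  ∃? {P = P} P? = map′ (λ (i , p) → to i , p)
    (λ (x , p) → from x , subst P (sym (strictlyInverseˡ x)) p) (any? (P? ∘ to))

  ¬¬-∀ : ∀ {P : Pred A a} → (∀ x → ¬ ¬ P x) → ¬ ¬ (∀ x → P x)
  ¬¬-∀ {P = P} ¬¬P = ¬¬-map (λ ∀P x → subst P (strictlyInverseˡ x) (∀P (from x)))
    (sequence (RawMonad.rawApplicative ¬¬-Monad) (¬¬P ∘ to))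

  spo-wellFounded′ : ∀ {r} {_<_ : Rel A r} → IsStrictPartialOrder _≡_ _<_ → WellFounded _<_
  spo-wellFounded′ {_<_ = _<_} <-isSPO =
    Subrelation.wellFounded
      (λ {x} {y} → subst₂ _<_ (sym (strictlyInverseˡ x)) (sym (strictlyInverseˡ y)))
      (On.wellFounded from (spo-wellFounded (On.isStrictPartialOrder to <-isSPO)))

_≟ᴱ_ : ∀ {n k} → Decidable {A = Elt n k} _≡_
_≟ᴱ_ = ≡-dec _≟_ _≟_

≼-¬¬-decidable : ∀ {n k} (P : FinPoset n k) → ¬ ¬ Decidable (FinPoset._≼_ P)
≼-¬¬-decidable {n} {k} P = ¬¬-∀ (λ x → ¬¬-∀ (λ y → ¬¬-excluded-middle))
  where open FiniteType (+↔⊎ {n} {k})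

withDecidableOrder : ∀ {n k} (P : FinPoset n k) {G : Set} →
  Dec G → (Decidable (FinPoset._≼_ P) → G) → G
withDecidableOrder P G? k = decidable-stable G? (¬¬-map k (≼-¬¬-decidable P))

module DecidableFinPoset {n k} (P : FinPoset n k) (_≼?_ : Decidable (FinPoset._≼_ P)) where
  open FinPoset P
  open IsPartialOrder isPartialOrder using () renaming (refl to ≼-refl; trans to ≼-trans)
  open FiniteType (+↔⊎ {n} {k})

  private
    _<_ : Elt n k → Elt n k → Set
    _<_ = _≺_ P
    _⋖_ : Elt n k → Elt n k → Set
    _⋖_ = Covers P

  <-isStrictPartialOrder : IsStrictPartialOrder _≡_ _<_
  <-isStrictPartialOrder = ToStrict.<-isStrictPartialOrder _≡_ _≼_ isPartialOrder

  <-wellFounded : WellFounded _<_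
  <-wellFounded = spo-wellFounded′ <-isStrictPartialOrder

  <-noetherian : WellFounded (flip _<_)
  <-noetherian = spo-wellFounded′ (Flip.isStrictPartialOrder <-isStrictPartialOrder)

  _<?_ : Decidable _<_
  x <? y = x ≼? y ×-dec ¬? (x ≟ᴱ y)

  minimal-or-above : ∀ x → Minimal P x ⊎ ∃ (λ w → w < x)
  minimal-or-above x with ∃? (λ w → w <? x)
  ... | yes below = inj₂ below
  ... | no none   = inj₁ (λ w w≼x → decidable-stable (w ≟ᴱ x) (λ w≢x → none (w , w≼x , w≢x)))

  ⋖-or-between : ∀ {x y} → x < y → x ⋖ y ⊎ ∃ (λ z → x < z × z < y)
  ⋖-or-between {x} {y} x<y with ∃? (λ z → x <? z ×-dec z <? y)
  ... | yes between = inj₂ between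
  ... | no none     = inj₁ (x<y , λ z x<z z<y → none (z , x<z , z<y))

  lowerCover : ∀ {x y} → x < y → ∃ λ z → x ≼ z × z ⋖ y
  lowerCover {x} {y} = go x (<-noetherian x)
    where
    go : ∀ x → Acc (flip _<_) x → x < y → ∃ λ z → x ≼ z × z ⋖ y
    go x (acc above) x<y with ⋖-or-between x<y
    ... | inj₁ x⋖y = x , ≼-refl , x⋖y
    ... | inj₂ (w , x<w , w<y) with go w (above x<w) w<y
    ...   | z , w≼z , z⋖y = z , ≼-trans (proj₁ x<w) w≼z , z⋖y

  ≼⇒Star-⋖ : ∀ {x y} → x ≼ y → Star _⋖_ x y
  ≼⇒Star-⋖ {x} {y} = go y (<-wellFounded y)
    where
    go : ∀ y → Acc _<_ y → x ≼ y → Star _⋖_ x y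
    go y (acc below) x≼y with x ≟ᴱ y
    ... | yes refl = ε
    ... | no x≢y with lowerCover (x≼y , x≢y)
    ...   | z , x≼z , z⋖y = go z (below (proj₁ z⋖y)) x≼z ◅◅ (z⋖y ◅ ε)

  chainFrom0 : ∀ x → ∃ (ChainFrom0 P x)
  chainFrom0 x = go x (<-wellFounded x)
    where
    go : ∀ x → Acc _<_ x → ∃ (ChainFrom0 P x)
    go x (acc below) with minimal-or-above x
    ... | inj₁ x-minimal = 1 , base x-minimal
    ... | inj₂ (w , w<x) with lowerCover w<x
    ...   | z , _ , z⋖x with go z (below (proj₁ z⋖x))
    ...     | ℓ , chain = suc ℓ , step chain z⋖x

  ⋖⇒rank-suc : ∀ {R} → IsRankFunction P R → ∀ {x y} → x ⋖ y → R y ≡ suc (R x)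
  ⋖⇒rank-suc R-rank {x} {y} x⋖y with chainFrom0 x
  ... | ℓ , chain = trans (R-rank y (suc ℓ) (step chain x⋖y)) (cong suc (sym (R-rank x ℓ chain)))

  ⋖-monotone⇒monotone : (g : Elt n k → ℚ) → (∀ {x y} → x ⋖ y → g x ≤ g y) →
                         ∀ {x y} → x ≼ y → g x ≤ g y
  ⋖-monotone⇒monotone g g-⋖ =
    fold (λ x y → g x ≤ g y) (λ x⋖y gy≤gz → ≤-trans (g-⋖ x⋖y) gy≤gz) ≤-refl ∘ ≼⇒Star-⋖

  -1≤arrowVec·⇔⋖-monotone : ∀ {R} → IsRankFunction P R → ∀ {f y : Vecℚ n} →
    y ≗ (λ i → f i - rank R (inj₁ i)) → ∀ {x z} → x ⋖ z →
    (- 1ℚ ≤ arrowVec P x z · y) ⇔ (extendByMarking R f x ≤ extendByMarking R f z)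
  -1≤arrowVec·⇔⋖-monotone {R} R-rank {f} {y} y≗f-R {x} {z} x⋖z =
    subst (λ q → (- 1ℚ ≤ q) ⇔ (a ≤ b)) (sym gap) (-1≤[b-[s+1]]-[a-s]⇔a≤b a b (rank R x))
    where
    a = extendByMarking R f x
    b = extendByMarking R f z
    gap : arrowVec P x z · y ≡ (b - (rank R x + 1ℚ)) - (a - rank R x)
    gap = begin
      arrowVec P x z · y                          ≡⟨ arrowVec-· P x z y ⟩
      extendByZero y z - extendByZero y x         ≡⟨ cong₂ _-_ (extendByZero-translate R y≗f-R z) (extendByZero-translate R y≗f-R x) ⟩
      (b - rank R z) - (a - rank R x)             ≡⟨ cong (λ s → (b - s) - (a - rank R x)) (trans (cong ℕtoℚ (⋖⇒rank-suc R-rank x⋖z)) (ℕtoℚ-suc (R x))) ⟩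
      (b - (rank R x + 1ℚ)) - (a - rank R x)      ∎

theorem4p10 : (m k : ℕ) (P : FinPoset (suc m) k) →
    IsStarredPoset P →
    (R : Elt (suc m) k → ℕ) → IsRankFunction P R →
    (y : Vecℚ (suc m)) →
    (PolarDual (Root P) y → TranslatedMOP P R y) ×
    (TranslatedMOP P R y → PolarDual (Root P) y)
theorem4p10 m k P P-starred R R-rank y = polar⇒translatedMOP , translatedMOP⇒polar
  where
  open DecidableFinPoset P using (⋖-monotone⇒monotone; -1≤arrowVec·⇔⋖-monotone)

  polar⇒translatedMOP : PolarDual (Root P) y → TranslatedMOP P R y
  polar⇒translatedMOP y° = f , monotone⇒MarkedOrderPolytope P R monotone , y≗f-R
    where
    f : Vecℚ (suc m)
    f i = y i + rank R (inj₁ i)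
    y≗f-R : y ≗ (λ i → f i - rank R (inj₁ i))
    y≗f-R i = sym (p+q-q≡p (y i) (rank R (inj₁ i)))
    monotone : ∀ {x z} → FinPoset._≼_ P x z → extendByMarking R f x ≤ extendByMarking R f z
    monotone x≼z = withDecidableOrder P (_ ≤? _) λ _≼?_ →
      ⋖-monotone⇒monotone _≼?_ (extendByMarking R f)
        (λ x⋖z → Equivalence.to (-1≤arrowVec·⇔⋖-monotone _≼?_ R-rank y≗f-R x⋖z)
                   (y° _ (∈⇒∈Conv (_ , _ , x⋖z , λ _ → refl))))
        x≼z

  translatedMOP⇒polar : TranslatedMOP P R y → PolarDual (Root P) y
  translatedMOP⇒polar (f , f∈MOP , y≗f-R) = PolarDual-Conv {v = y} λ u (x , z , x⋖z , u≗arrow) →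
    withDecidableOrder P (_ ≤? _) λ _≼?_ →
      subst (- 1ℚ ≤_) (sym (·-congˡ y u≗arrow))
        (Equivalence.from (-1≤arrowVec·⇔⋖-monotone _≼?_ R-rank y≗f-R x⋖z)
          (MarkedOrderPolytope⇒⋖-monotone P R P-starred f∈MOP x⋖z))
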